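{- Let $y:\mathbb{N}\to\mathbb{R}$ be any monotone increasing function with $\frac{n}{2}<y(n)<n$ for all $n\in\mathbb{N}$, and let $\mathcal{F}_y$ be the set of $y$-smooth positive integers. Then $\mathcal{F}_y$ is not totally a-primitive. In particular, $$\mathcal{F}_y\cap[9,+\infty)=\mathcal{A}+\mathcal{B},$$ where $\mathcal{A}=\{n\in\mathbb{N}:\ \text{none of } n,\,n+1,\,n+3,\,n+5 \text{ is prime}\}$ and $\mathcal{B}=\{0,1,3,5\}$.
   Context: $\mathbb{N}$ denotes the positive integers and $\mathbb{N}_0=\mathbb{N}\cup\{0\}$. For $n\in\mathbb{N}$, $p^+(n)$ denotes the greatest prime factor of $n$. For a monotone increasing positive function $y$ on $\mathbb{N}$, a positive integer $n$ is called $y$-smooth if $p^+(n)\le y(n)$, and $\mathcal{F}_y$ is the set of all $y$-smooth positive integers. For sets $\mathcal{B},\mathcal{C}$ of integers, $\mathcal{B}+\mathcal{C}=\{b+c:b\in\mathcal{B},c\in\mathcal{C}\}$. A set $\mathcal{A}\subset\mathbb{N}_0$ is a-reducible if $\mathcal{A}=\mathcal{B}+\mathcal{C}$ for some $\mathcal{B},\mathcal{C}\subset\mathbb{N}_0$ with $|\mathcal{B}|\ge2$, $|\mathcal{C}|\ge2$; otherwise it is a-primitive. Two sets $\mathcal{A},\mathcal{A}'$ of non-negative integers are asymptotically equal, written $\mathcal{A}\sim\mathcal{A}'$, if there is $K$ with $\mathcal{A}\cap[K,+\infty)=\mathcal{A}'\cap[K,+\infty)$. An infinite set $\mathcal{A}\subset\mathbb{N}_0$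 is totally a-primitive if every $\mathcal{A}'\subset\mathbb{N}_0$ with $\mathcal{A}'\sim\mathcal{A}$ is a-primitive. -}

module Defs where

open import Level using (0ℓ)
open import Data.Nat using (ℕ; _+_; _*_; _≤_; _<_)
open import Data.Nat.Divisibility using (_∣_)
open import Data.Nat.Primality using (Prime)
open import Data.Product using (Σ; ∃; ∃-syntax; _×_)
open import Data.Sum using (_⊎_)
open import Relation.Nullary using (¬_)
open import Relation.Binary.PropositionalEquality using (_≡_; _≢_)
open import Relation.Unary using (Pred)
open import Function.Bundles using (_⇔_)

NatSet : Set₁
NatSet = Pred ℕ 0ℓ

-- A monotone increasing function y : ℕ → ℝ with n/2 < y(n) < n (n ≥ 1).
-- Since y is only ever compared with integers (p⁺(n) ≤ y(n)), it is represented
-- by the relation  Le n k  :≡  "k ≤ y(n)"  for natural k, together with exactly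
-- the integer consequences of the hypotheses.
record SmoothBound : Set₁ where
  field
    Le    : ℕ → ℕ → Set
    down  : ∀ {n j k} → j ≤ k → Le n k → Le n j
    mono  : ∀ {m n k} → 1 ≤ m → m ≤ n → Le m k → Le n k
    -- n/2 < y(n): every integer k with 2k ≤ n satisfies k ≤ y(n)
    lower : ∀ {n k} → 1 ≤ n → 2 * k ≤ n → Le n k
    upper : ∀ {n} → 1 ≤ n → ¬ Le n n

IsGPF : ℕ → ℕ → Set
IsGPF n p = (n ≡ 1 × p ≡ 1)
          ⊎ (Prime p × p ∣ n × (∀ q → Prime q → q ∣ n → q ≤ p))

Smooth : SmoothBound → NatSet
Smooth y n = 1 ≤ n × ∃[ p ] (IsGPF n p × SmoothBound.Le y n p)

IsSumset : NatSet → NatSet → NatSet → Set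
IsSumset B C S = ∀ n → S n ⇔ (∃[ b ] ∃[ c ] (B b × C c × n ≡ b + c))

HasTwo : NatSet → Set
HasTwo B = ∃[ a ] ∃[ b ] (B a × B b × a ≢ b)

AReducible : NatSet → Set₁
AReducible S = Σ NatSet λ B → Σ NatSet λ C → HasTwo B × HasTwo C × IsSumset B C S

APrimitive : NatSet → Set₁
APrimitive S = ¬ AReducible S

AsymEq : NatSet → NatSet → Set
AsymEq S T = ∃[ K ] (∀ n → K ≤ n → S n ⇔ T n)

Infinite : NatSet → Set
Infinite S = ∀ m → ∃[ n ] (m ≤ n × S n)

TotallyAPrimitive : NatSet → Set₁
TotallyAPrimitive S = Infinite S × (∀ (T : NatSet) → AsymEq T S → APrimitive T)

SetA : NatSet
SetA n = 1 ≤ n × ¬ Prime n × ¬ Prime (n + 1) × ¬ Prime (n + 3) × ¬ Prime (n + 5)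

SetB : NatSet
SetB b = b ≡ 0 ⊎ b ≡ 1 ⊎ b ≡ 3 ⊎ b ≡ 5

SmoothFrom9 : SmoothBound → NatSet
SmoothFrom9 y n = 9 ≤ n × Smooth y n

{-# OPTIONS --safe #-}
module Submission where

-- For n/2 < y(n) < n, an integer n ≥ 2 is y-smooth exactly when it is composite: a prime n is
-- its own greatest prime factor and exceeds y(n), while every prime factor of a composite n is
-- at most n/2. So 𝓕_y ∩ [9,∞) is the set of composites ≥ 9. An odd composite a ≥ 9 lies in 𝓐
-- because a+1, a+3, a+5 are even, and an even n ≥ 10 is 9 + 6q + b with b ∈ {1,3,5}, where
-- 9 + 6q lies in 𝓐 as an odd multiple of 3. Conversely every element of 𝓐 is at least 9, and
-- a + b is composite by the definition of 𝓐. Hence the tail 𝓕_y ∩ [9,∞) is a-reducible.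

open import Defs
open import Data.Fin using (zero; suc)
open import Data.List using ([]; _∷_)
open import Data.List.Extrema.Nat using (max; v≤max⁺; argmax-all)
open import Data.List.Membership.Propositional using (_∈_)
open import Data.List.Relation.Unary.All as All using (All)
open import Data.List.Relation.Unary.Any using (here; there)
import Data.List.Relation.Unary.Any as Any
open import Data.Nat
open import Data.Nat.DivMod using (_divMod_; result)
open import Data.Nat.Divisibility
open import Data.Nat.ListAction.Properties using (∈⇒∣product)
open import Data.Nat.Primality
open import Data.Nat.Primality.Factorisation using (factorise; factorisationHasAllPrimeFactors)
open import Data.Nat.Properties
open import Data.Nat.Tactic.RingSolver using (solve)
open import Data.Product using (_×_; _,_; proj₁; proj₂; ∃-syntax)
open import Data.Sum using (inj₁; inj₂)
open import Function using (id; _∘_)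
open import Function.Bundles using (_⇔_; mk⇔)
open import Function.Construct.Composition using (_⇔-∘_)
open import Relation.Nullary using (¬_; contradiction)
open import Relation.Nullary.Decidable using (from-yes; from-no)
open import Relation.Binary.PropositionalEquality

greatestPrimeFactor : ∀ n → .{{NonTrivial n}} →
  ∃[ p ] (Prime p × p ∣ n × (∀ q → Prime q → q ∣ n → q ≤ p))
greatestPrimeFactor n with factorise n {{nonTrivial⇒nonZero n}}
... | record { factors = [] ; isFactorisation = n≡1 } = contradiction n≡1 nonTrivial⇒≢1
... | record { factors = p ∷ ps ; isFactorisation = n≡∏ ; factorsPrime = primes } =
  max p ps , proj₁ maxPrimeFactor , proj₂ maxPrimeFactor , maximal
  where
  ∈⇒∣n : ∀ {q} → q ∈ p ∷ ps → q ∣ n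
  ∈⇒∣n q∈ = subst (_ ∣_) (sym n≡∏) (∈⇒∣product q∈)
  primeFactor : All (λ q → Prime q × q ∣ n) (p ∷ ps)
  primeFactor = All.tabulate (λ q∈ → All.lookup primes q∈ , ∈⇒∣n q∈)
  maxPrimeFactor : Prime (max p ps) × max p ps ∣ n
  maxPrimeFactor = argmax-all id (All.head primeFactor) (All.tail primeFactor)
  maximal : ∀ q → Prime q → q ∣ n → q ≤ max p ps
  maximal q q-prime q∣n with factorisationHasAllPrimeFactors q-prime (subst (q ∣_) n≡∏ q∣n) primes
  ... | here refl = v≤max⁺ p ps (inj₁ ≤-refl)
  ... | there q∈ps = v≤max⁺ p ps (inj₂ (Any.map ≤-reflexive q∈ps))

proper-divisor⇒2*≤ : ∀ {m n} .{{_ : NonZero n}} → m ∣ n → m ≢ n → 2 * m ≤ n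
proper-divisor⇒2*≤ {n = n} (divides zero n≡0) _ = contradiction n≡0 (≢-nonZero⁻¹ n)
proper-divisor⇒2*≤ {m} (divides 1 refl) m≢n = contradiction (sym (+-identityʳ m)) m≢n
proper-divisor⇒2*≤ {m} (divides (2+ q) refl) _ = *-monoˡ-≤ m {2} {2+ q} (s≤s (s≤s z≤n))

_⊕_ : NatSet → NatSet → NatSet
(B ⊕ C) n = ∃[ b ] ∃[ c ] (B b × C c × n ≡ b + c)

CompositeFrom9 : NatSet
CompositeFrom9 n = 9 ≤ n × ¬ Prime n

module _ (y : SmoothBound) where
  open SmoothBound y

  smooth⇒¬prime : ∀ {n} → Smooth y n → ¬ Prime n
  smooth⇒¬prime (_ , _ , inj₁ (refl , _) , _) 1-prime = nonTrivial⇒≢1 {{prime⇒nonTrivial 1-prime}} refl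
  smooth⇒¬prime (1≤n , _ , inj₂ (_ , _ , maximal) , n≤p) n-prime =
    upper 1≤n (down (maximal _ n-prime ∣-refl) n≤p)

  ¬prime⇒smooth : ∀ {n} → 2 ≤ n → ¬ Prime n → Smooth y n
  ¬prime⇒smooth {n} 2≤n ¬prime with greatestPrimeFactor n {{n>1⇒nonTrivial 2≤n}}
  ... | p , p-prime , p∣n , maximal =
    1≤n , p , inj₂ (p-prime , p∣n , maximal) ,
    lower 1≤n (proper-divisor⇒2*≤ {{>-nonZero 1≤n}} p∣n λ { refl → ¬prime p-prime })
    where
    1≤n : 1 ≤ n
    1≤n = ≤-trans (s≤s z≤n) 2≤n

  smoothFrom9⇔compositeFrom9 : ∀ {n} → SmoothFrom9 y n ⇔ CompositeFrom9 n
  smoothFrom9⇔compositeFrom9 = mk⇔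
    (λ (9≤n , smooth) → 9≤n , smooth⇒¬prime smooth)
    (λ (9≤n , ¬prime) → 9≤n , ¬prime⇒smooth (≤-trans (s≤s (s≤s z≤n)) 9≤n) ¬prime)

odd∧¬prime⇒A : ∀ {n} → ¬ Prime n → ∀ k → n ≡ 7 + 2 * k → SetA n
odd∧¬prime⇒A ¬prime k refl =
  s≤s z≤n , ¬prime , composite⇒¬prime (even 0) , composite⇒¬prime (even 1) , composite⇒¬prime (even 2)
  where
  even : ∀ j → Composite (7 + 2 * k + (1 + 2 * j))
  even j = composite {2} (s<s (s<s z<s)) (divides (4 + k + j) (solve (k ∷ j ∷ [])))

9+q*6∈A : ∀ q → SetA (9 + q * 6)
9+q*6∈A q = odd∧¬prime⇒A (composite⇒¬prime multipleOf3) (1 + 3 * q) (solve (q ∷ []))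
  where
  multipleOf3 : Composite (9 + q * 6)
  multipleOf3 = composite {3} (s<s (s<s (s<s z<s))) (divides (3 + 2 * q) (solve (q ∷ [])))

A⇒9≤ : ∀ {a} → SetA a → 9 ≤ a
A⇒9≤ {0} (() , _)
A⇒9≤ {1} (_ , _ , ¬prime[2] , _) = contradiction prime[2] ¬prime[2]
A⇒9≤ {2} (_ , ¬prime[2] , _) = contradiction prime[2] ¬prime[2]
A⇒9≤ {3} (_ , ¬prime[3] , _) = contradiction (from-yes (prime? 3)) ¬prime[3]
A⇒9≤ {4} (_ , _ , ¬prime[5] , _) = contradiction (from-yes (prime? 5)) ¬prime[5]
A⇒9≤ {5} (_ , ¬prime[5] , _) = contradiction (from-yes (prime? 5)) ¬prime[5]
A⇒9≤ {6} (_ , _ , ¬prime[7] , _) = contradiction (from-yes (prime? 7)) ¬prime[7]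
A⇒9≤ {7} (_ , ¬prime[7] , _) = contradiction (from-yes (prime? 7)) ¬prime[7]
A⇒9≤ {8} (_ , _ , _ , ¬prime[11] , _) = contradiction (from-yes (prime? 11)) ¬prime[11]
A⇒9≤ {suc (suc (suc (suc (suc (suc (suc (suc (suc k))))))))} _ = m≤m+n 9 k

A+B⇒¬prime : ∀ {a b} → SetA a → SetB b → ¬ Prime (a + b)
A+B⇒¬prime {a} (_ , ¬prime , _) (inj₁ refl) = subst (¬_ ∘ Prime) (sym (+-identityʳ a)) ¬prime
A+B⇒¬prime (_ , _ , ¬prime , _) (inj₂ (inj₁ refl)) = ¬prime
A+B⇒¬prime (_ , _ , _ , ¬prime , _) (inj₂ (inj₂ (inj₁ refl))) = ¬prime
A+B⇒¬prime (_ , _ , _ , _ , ¬prime) (inj₂ (inj₂ (inj₂ refl))) = ¬prime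

odd-composite∈A⊕B : ∀ {n} → ¬ Prime n → ∀ k → n ≡ 7 + 2 * k → (SetA ⊕ SetB) n
odd-composite∈A⊕B {n} ¬prime k n≡ = n , 0 , odd∧¬prime⇒A ¬prime k n≡ , inj₁ refl , sym (+-identityʳ n)

composite⇒A⊕B : ∀ {n} → CompositeFrom9 n → (SetA ⊕ SetB) n
composite⇒A⊕B (9≤n , ¬prime) with m≤n⇒∃[o]m+o≡n 9≤n
... | m , refl with m divMod 6
... | result q zero refl = odd-composite∈A⊕B ¬prime (1 + 3 * q) (solve (q ∷ []))
... | result q (suc zero) refl = 9 + q * 6 , 1 , 9+q*6∈A q , inj₂ (inj₁ refl) , solve (q ∷ [])
... | result q (suc (suc zero)) refl = odd-composite∈A⊕B ¬prime (2 + 3 * q) (solve (q ∷ []))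
... | result q (suc (suc (suc zero))) refl = 9 + q * 6 , 3 , 9+q*6∈A q , inj₂ (inj₂ (inj₁ refl)) , solve (q ∷ [])
... | result q (suc (suc (suc (suc zero)))) refl = odd-composite∈A⊕B ¬prime (3 + 3 * q) (solve (q ∷ []))
... | result q (suc (suc (suc (suc (suc zero))))) refl = 9 + q * 6 , 5 , 9+q*6∈A q , inj₂ (inj₂ (inj₂ refl)) , solve (q ∷ [])

A⊕B⇒composite : ∀ {n} → (SetA ⊕ SetB) n → CompositeFrom9 n
A⊕B⇒composite (a , b , a∈A , b∈B , refl) = ≤-trans (A⇒9≤ a∈A) (m≤m+n a b) , A+B⇒¬prime a∈A b∈B

compositeFrom9-isSumset : IsSumset SetA SetB CompositeFrom9
compositeFrom9-isSumset n = mk⇔ composite⇒A⊕B A⊕B⇒composite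

IsSumset-resp-⇔ : ∀ {B C S T} → (∀ {n} → S n ⇔ T n) → IsSumset B C T → IsSumset B C S
IsSumset-resp-⇔ S⇔T B+C≡T n = B+C≡T n ⇔-∘ S⇔T

reducibleTail⇒¬totallyAPrimitive : ∀ K S → AReducible (λ n → K ≤ n × S n) → ¬ TotallyAPrimitive S
reducibleTail⇒¬totallyAPrimitive K S reducible (_ , tailsPrimitive) =
  tailsPrimitive _ (K , λ _ K≤n → mk⇔ proj₂ (K≤n ,_)) reducible

twoInA : HasTwo SetA
twoInA = 9 , 25 ,
  (s≤s z≤n , from-no (prime? 9) , from-no (prime? 10) , from-no (prime? 12) , from-no (prime? 14)) ,
  (s≤s z≤n , from-no (prime? 25) , from-no (prime? 26) , from-no (prime? 28) , from-no (prime? 30)) ,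
  λ ()

twoInB : HasTwo SetB
twoInB = 0 , 1 , inj₁ refl , inj₂ (inj₁ refl) , λ ()

theorem1 : (y : SmoothBound) →
    ¬ TotallyAPrimitive (Smooth y) × IsSumset SetA SetB (SmoothFrom9 y)
theorem1 y = reducibleTail⇒¬totallyAPrimitive 9 (Smooth y) (SetA , SetB , twoInA , twoInB , sumset) , sumset
  where
  sumset : IsSumset SetA SetB (SmoothFrom9 y)
  sumset = IsSumset-resp-⇔ (smoothFrom9⇔compositeFrom9 y) compositeFrom9-isSumset
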